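{- Let $Y_0 = \lambda f.\,\omega_f\,\omega_f$ with $\omega_f = \lambda x.\,f(xx)$, $B = \lambda xyz.\,x(yz)$, $S = \lambda xyz.\,xz(yz)$, $I = \lambda x.x$, and for $n \geq 0$ let $U_n = B\,Y_0\,S\,S\cdots S\,I$ with $n$ copies of $S$ (application associating to the left). Then the sequence $U_0, U_1, U_2, \ldots$ contains no duplicates: $U_n \neq_\beta U_m$ whenever $n \neq m$.
   Context: Untyped $\lambda$-calculus with $\beta$-conversion. -}

module Defs where

open import Data.Nat using (ℕ; zero; suc)
open import Data.Fin using (Fin; zero; suc)
open import Relation.Binary.Construct.Closure.Equivalence using (EqClosure)

-- Untyped λ-terms, well-scoped de Bruijn representation:
-- Term n = terms with at most n free variables.
data Term (n : ℕ) : Set where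
  var : Fin n → Term n
  ƛ_  : Term (suc n) → Term n
  _·_ : Term n → Term n → Term n

infixl 7 _·_
infixr 5 ƛ_

Ren : ℕ → ℕ → Set
Ren m n = Fin m → Fin n

ext : ∀ {m n} → Ren m n → Ren (suc m) (suc n)
ext ρ zero    = zero
ext ρ (suc i) = suc (ρ i)

rename : ∀ {m n} → Ren m n → Term m → Term n
rename ρ (var i) = var (ρ i)
rename ρ (ƛ t)   = ƛ rename (ext ρ) t
rename ρ (t · u) = rename ρ t · rename ρ u

Sub : ℕ → ℕ → Set
Sub m n = Fin m → Term n

exts : ∀ {m n} → Sub m n → Sub (suc m) (suc n)
exts σ zero    = var zero
exts σ (suc i) = rename suc (σ i)

subst : ∀ {m n} → Sub m n → Term m → Term n
subst σ (var i) = σ i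
subst σ (ƛ t)   = ƛ subst (exts σ) t
subst σ (t · u) = subst σ t · subst σ u

single : ∀ {n} → Term n → Sub (suc n) n
single u zero    = u
single u (suc i) = var i

_[_] : ∀ {n} → Term (suc n) → Term n → Term n
t [ u ] = subst (single u) t

data _⟶β_ {n : ℕ} : Term n → Term n → Set where
  β    : ∀ {t : Term (suc n)} {u} → (ƛ t) · u ⟶β t [ u ]
  ξƛ   : ∀ {t t' : Term (suc n)} → t ⟶β t' → ƛ t ⟶β ƛ t'
  ξ·ₗ  : ∀ {t t' u : Term n} → t ⟶β t' → t · u ⟶β t' · u
  ξ·ᵣ  : ∀ {t u u' : Term n} → u ⟶β u' → t · u ⟶β t · u'

infix 4 _⟶β_ _=β_

_=β_ : ∀ {n} → Term n → Term n → Set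
_=β_ {n} = EqClosure (_⟶β_ {n})

x0 x1 x2 : ∀ {n} → Term (suc (suc (suc n)))
x0 = var zero
x1 = var (suc zero)
x2 = var (suc (suc zero))

-- ω_f = λx. f (x x)   (under the binder f)
ωf : Term 1
ωf = ƛ (var (suc zero) · (var zero · var zero))

Y₀ : Term 0
Y₀ = ƛ (ωf · ωf)

-- B = λxyz. x (y z)   (x = index 2, y = 1, z = 0)
B : Term 0
B = ƛ ƛ ƛ (x2 · (x1 · x0))

S : Term 0
S = ƛ ƛ ƛ (x2 · x0 · (x1 · x0))

I : Term 0
I = ƛ var zero

BY₀Sⁿ : ℕ → Term 0
BY₀Sⁿ zero    = B · Y₀
BY₀Sⁿ (suc n) = BY₀Sⁿ n · S

U : ℕ → Term 0
U n = BY₀Sⁿ n · I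

module Submission where

-- The combinators U n all reduce to fixed-point combinators (Y₀, Turing's Θ,
-- and Ωs S ⋯ S I), which have no normal form and share the Böhm tree
-- λf. f (f (f ⋯)); they are told apart by an invariant of β-reduction.
--
-- 1. Church–Rosser for β: parallel reduction ⇛ satisfies Takahashi's
--    triangle property, hence the diamond property, hence β is confluent,
--    hence β-convertible terms have a common reduct.
-- 2. A sort assignment, parameterised by a set of sorts, an arrow relation
--    Arr s a b ("sort s applied to sort a gives sort b") and a predicate Lam
--    of sorts allowed for abstractions.  An abstraction gets sort s when its
--    body gets sort b under x : a for EVERY arrow Arr s a b; this makes sorts
--    stable under β-reduction (subject reduction).
-- 3. An apartness relation # on sorts that is compatible with application
--    and abstraction forbids one term from having two apart sorts; with 1 and 2,
--    terms with apart sorts are not β-convertible.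
-- 4. A concrete sort structure in which U n reduces to a term T n of sort
--    R n, and R n # R m whenever n ≢ m.

open import Defs
open import Data.Nat using (ℕ; zero; suc)
open import Data.Fin using (Fin; zero; suc)
open import Data.Empty using (⊥-elim)
open import Data.Product using (∃; _×_; _,_)
open import Data.Sum using (_⊎_; inj₁; inj₂)
import Data.Sum as Sum
open import Function using (_∘_)
open import Level using (0ℓ)
open import Relation.Binary.Core using (Rel)
open import Relation.Binary.PropositionalEquality
  using (_≡_; _≢_; _≗_; refl; sym; trans; cong; cong₂; module ≡-Reasoning)
open import Relation.Nullary using (¬_)
open import Relation.Binary.Rewriting using (Confluent)
open import Relation.Binary.Construct.Closure.ReflexiveTransitive as Star
  using (Star; ε; _◅_; _◅◅_)
open import Relation.Binary.Construct.Closure.Symmetric using (SymClosure; fwd; bwd)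
import Relation.Binary.Construct.Closure.Symmetric as SymClosure
open import Relation.Binary.Construct.Closure.Equivalence using (EqClosure)
open import Relation.Binary.Construct.Closure.Equivalence.Properties
  using (a—↠b⇒a↔b; a—↠b⇒b↔a)

Diamond : ∀ {A : Set} → Rel A 0ℓ → Set
Diamond _⟶_ = ∀ {a b c} → a ⟶ b → a ⟶ c → ∃ λ d → b ⟶ d × c ⟶ d

module _ {A : Set} {_⟶_ : Rel A 0ℓ} where

  strip : Diamond _⟶_ → ∀ {a b c} → a ⟶ b → Star _⟶_ a c →
          ∃ λ d → Star _⟶_ b d × c ⟶ d
  strip ◇ p ε = _ , ε , p
  strip ◇ p (q ◅ qs) with ◇ p q
  ... | d , p' , q' with strip ◇ q' qs
  ... | e , rs , r = e , p' ◅ rs , r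

  diamond⇒confluent : Diamond _⟶_ → Confluent _⟶_
  diamond⇒confluent ◇ ε qs = _ , qs , ε
  diamond⇒confluent ◇ (p ◅ ps) qs with strip ◇ p qs
  ... | d , rs , r with diamond⇒confluent ◇ ps rs
  ... | e , ps' , rs' = e , ps' , r ◅ rs'

  confluent⇒church-rosser : Confluent _⟶_ → ∀ {a b} → EqClosure _⟶_ a b →
                            ∃ λ d → Star _⟶_ a d × Star _⟶_ b d
  confluent⇒church-rosser conf ε = _ , ε , ε
  confluent⇒church-rosser conf (fwd p ◅ ps) with confluent⇒church-rosser conf ps
  ... | d , qs , rs = d , p ◅ qs , rs
  confluent⇒church-rosser conf (bwd p ◅ ps) with confluent⇒church-rosser conf ps
  ... | d , qs , rs with conf (p ◅ ε) qs
  ... | e , qs' , rs' = e , qs' , rs ◅◅ rs'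

confluent-sandwich : ∀ {A : Set} {_⟶_ _⇛_ : Rel A 0ℓ} →
                     (∀ {a b} → a ⟶ b → a ⇛ b) →
                     (∀ {a b} → a ⇛ b → Star _⟶_ a b) →
                     Confluent _⇛_ → Confluent _⟶_
confluent-sandwich ⟶⊆⇛ ⇛⊆⟶* conf ps qs
  with conf (Star.map ⟶⊆⇛ ps) (Star.map ⟶⊆⇛ qs)
... | d , ps' , qs' = d , Star.concat (Star.map ⇛⊆⟶* ps') , Star.concat (Star.map ⇛⊆⟶* qs')

ext-cong : ∀ {m n} {ρ ρ' : Ren m n} → ρ ≗ ρ' → ext ρ ≗ ext ρ'
ext-cong e zero    = refl
ext-cong e (suc i) = cong suc (e i)

rename-cong : ∀ {m n} {ρ ρ' : Ren m n} → ρ ≗ ρ' → rename ρ ≗ rename ρ'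
rename-cong e (var i) = cong var (e i)
rename-cong e (ƛ t)   = cong ƛ_ (rename-cong (ext-cong e) t)
rename-cong e (t · u) = cong₂ _·_ (rename-cong e t) (rename-cong e u)

exts-cong : ∀ {m n} {σ σ' : Sub m n} → σ ≗ σ' → exts σ ≗ exts σ'
exts-cong e zero    = refl
exts-cong e (suc i) = cong (rename suc) (e i)

subst-cong : ∀ {m n} {σ σ' : Sub m n} → σ ≗ σ' → subst σ ≗ subst σ'
subst-cong e (var i) = e i
subst-cong e (ƛ t)   = cong ƛ_ (subst-cong (exts-cong e) t)
subst-cong e (t · u) = cong₂ _·_ (subst-cong e t) (subst-cong e u)

ext-∘ : ∀ {l m n} (ρ : Ren m n) (ρ' : Ren l m) → ext ρ ∘ ext ρ' ≗ ext (ρ ∘ ρ')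
ext-∘ ρ ρ' zero    = refl
ext-∘ ρ ρ' (suc i) = refl

rename-∘ : ∀ {l m n} (ρ : Ren m n) (ρ' : Ren l m) t →
           rename ρ (rename ρ' t) ≡ rename (ρ ∘ ρ') t
rename-∘ ρ ρ' (var i) = refl
rename-∘ ρ ρ' (ƛ t)   =
  cong ƛ_ (trans (rename-∘ (ext ρ) (ext ρ') t) (rename-cong (ext-∘ ρ ρ') t))
rename-∘ ρ ρ' (t · u) = cong₂ _·_ (rename-∘ ρ ρ' t) (rename-∘ ρ ρ' u)

exts-ext : ∀ {l m n} (σ : Sub m n) (ρ : Ren l m) → exts σ ∘ ext ρ ≗ exts (σ ∘ ρ)
exts-ext σ ρ zero    = refl
exts-ext σ ρ (suc i) = refl

subst-rename : ∀ {l m n} (σ : Sub m n) (ρ : Ren l m) t →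
               subst σ (rename ρ t) ≡ subst (σ ∘ ρ) t
subst-rename σ ρ (var i) = refl
subst-rename σ ρ (ƛ t)   =
  cong ƛ_ (trans (subst-rename (exts σ) (ext ρ) t) (subst-cong (exts-ext σ ρ) t))
subst-rename σ ρ (t · u) = cong₂ _·_ (subst-rename σ ρ t) (subst-rename σ ρ u)

rename-subst : ∀ {l m n} (ρ : Ren m n) (σ : Sub l m) t →
               rename ρ (subst σ t) ≡ subst (rename ρ ∘ σ) t
rename-subst ρ σ (var i) = refl
rename-subst ρ σ (ƛ t)   =
  cong ƛ_ (trans (rename-subst (ext ρ) (exts σ) t) (subst-cong ext-exts t))
  where
  ext-exts : rename (ext ρ) ∘ exts σ ≗ exts (rename ρ ∘ σ)
  ext-exts zero    = refl
  ext-exts (suc i) = trans (rename-∘ (ext ρ) suc (σ i)) (sym (rename-∘ suc ρ (σ i)))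
rename-subst ρ σ (t · u) = cong₂ _·_ (rename-subst ρ σ t) (rename-subst ρ σ u)

subst-subst : ∀ {l m n} (σ : Sub m n) (τ : Sub l m) t →
              subst σ (subst τ t) ≡ subst (subst σ ∘ τ) t
subst-subst σ τ (var i) = refl
subst-subst σ τ (ƛ t)   =
  cong ƛ_ (trans (subst-subst (exts σ) (exts τ) t) (subst-cong exts-exts t))
  where
  exts-exts : subst (exts σ) ∘ exts τ ≗ exts (subst σ ∘ τ)
  exts-exts zero    = refl
  exts-exts (suc i) = trans (subst-rename (exts σ) suc (τ i)) (sym (rename-subst suc σ (τ i)))
subst-subst σ τ (t · u) = cong₂ _·_ (subst-subst σ τ t) (subst-subst σ τ u)

exts-var : ∀ {n} → exts (var {n}) ≗ var
exts-var zero    = refl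
exts-var (suc i) = refl

subst-var : ∀ {n} (t : Term n) → subst var t ≡ t
subst-var (var i) = refl
subst-var (ƛ t)   = cong ƛ_ (trans (subst-cong exts-var t) (subst-var t))
subst-var (t · u) = cong₂ _·_ (subst-var t) (subst-var u)

rename-[] : ∀ {m n} (ρ : Ren m n) t u →
            rename ρ (t [ u ]) ≡ rename (ext ρ) t [ rename ρ u ]
rename-[] ρ t u = begin
  rename ρ (t [ u ])                          ≡⟨ rename-subst ρ (single u) t ⟩
  subst (rename ρ ∘ single u) t               ≡⟨ subst-cong pointwise t ⟩
  subst (single (rename ρ u) ∘ ext ρ) t       ≡⟨ subst-rename (single (rename ρ u)) (ext ρ) t ⟨
  rename (ext ρ) t [ rename ρ u ]             ∎
  where
  open ≡-Reasoning
  pointwise : rename ρ ∘ single u ≗ single (rename ρ u) ∘ ext ρ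
  pointwise zero    = refl
  pointwise (suc i) = refl

subst-[] : ∀ {m n} (σ : Sub m n) t u →
           subst σ (t [ u ]) ≡ subst (exts σ) t [ subst σ u ]
subst-[] σ t u = begin
  subst σ (t [ u ])                              ≡⟨ subst-subst σ (single u) t ⟩
  subst (subst σ ∘ single u) t                   ≡⟨ subst-cong pointwise t ⟩
  subst (subst (single (subst σ u)) ∘ exts σ) t  ≡⟨ subst-subst (single (subst σ u)) (exts σ) t ⟨
  subst (exts σ) t [ subst σ u ]                 ∎
  where
  open ≡-Reasoning
  pointwise : subst σ ∘ single u ≗ subst (single (subst σ u)) ∘ exts σ
  pointwise zero    = refl
  pointwise (suc i) = sym (trans (subst-rename (single (subst σ u)) suc (σ i)) (subst-var (σ i)))

infix 4 _⇛_ _↠_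

_↠_ : ∀ {n} → Rel (Term n) 0ℓ
_↠_ = Star _⟶β_

data _⇛_ {n : ℕ} : Term n → Term n → Set where
  pvar : ∀ {i} → var i ⇛ var i
  pƛ   : ∀ {t t'} → t ⇛ t' → ƛ t ⇛ ƛ t'
  p·   : ∀ {t t' u u'} → t ⇛ t' → u ⇛ u' → t · u ⇛ t' · u'
  pβ   : ∀ {t t' u u'} → t ⇛ t' → u ⇛ u' → (ƛ t) · u ⇛ t' [ u' ]

⇛-refl : ∀ {n} (t : Term n) → t ⇛ t
⇛-refl (var i) = pvar
⇛-refl (ƛ t)   = pƛ (⇛-refl t)
⇛-refl (t · u) = p· (⇛-refl t) (⇛-refl u)

⇛-rename : ∀ {m n} (ρ : Ren m n) {t t'} → t ⇛ t' → rename ρ t ⇛ rename ρ t'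
⇛-rename ρ pvar     = pvar
⇛-rename ρ (pƛ p)   = pƛ (⇛-rename (ext ρ) p)
⇛-rename ρ (p· p q) = p· (⇛-rename ρ p) (⇛-rename ρ q)
⇛-rename ρ (pβ {t' = t'} {u' = u'} p q) rewrite rename-[] ρ t' u' =
  pβ (⇛-rename (ext ρ) p) (⇛-rename ρ q)

_⇛ˢ_ : ∀ {m n} → Sub m n → Sub m n → Set
σ ⇛ˢ σ' = ∀ i → σ i ⇛ σ' i

⇛ˢ-exts : ∀ {m n} {σ σ' : Sub m n} → σ ⇛ˢ σ' → exts σ ⇛ˢ exts σ'
⇛ˢ-exts σ⇛σ' zero    = pvar
⇛ˢ-exts σ⇛σ' (suc i) = ⇛-rename suc (σ⇛σ' i)

⇛-subst : ∀ {m n} {σ σ' : Sub m n} → σ ⇛ˢ σ' →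
          ∀ {t t'} → t ⇛ t' → subst σ t ⇛ subst σ' t'
⇛-subst σ⇛σ' pvar     = σ⇛σ' _
⇛-subst σ⇛σ' (pƛ p)   = pƛ (⇛-subst (⇛ˢ-exts σ⇛σ') p)
⇛-subst σ⇛σ' (p· p q) = p· (⇛-subst σ⇛σ' p) (⇛-subst σ⇛σ' q)
⇛-subst {σ' = σ'} σ⇛σ' (pβ {t' = t'} {u' = u'} p q) rewrite subst-[] σ' t' u' =
  pβ (⇛-subst (⇛ˢ-exts σ⇛σ') p) (⇛-subst σ⇛σ' q)

⇛-[] : ∀ {n} {t t' : Term (suc n)} {u u'} → t ⇛ t' → u ⇛ u' → t [ u ] ⇛ t' [ u' ]
⇛-[] p q = ⇛-subst (λ { zero → q ; (suc i) → pvar }) p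

_⁺ : ∀ {n} → Term n → Term n
var i ⁺           = var i
(ƛ t) ⁺           = ƛ (t ⁺)
(var i · u) ⁺     = var i · (u ⁺)
((t · t') · u) ⁺  = ((t · t') ⁺) · (u ⁺)
((ƛ t) · u) ⁺     = (t ⁺) [ u ⁺ ]

triangle : ∀ {n} {t t' : Term n} → t ⇛ t' → t' ⇛ t ⁺
triangle pvar                          = pvar
triangle (pƛ p)                        = pƛ (triangle p)
triangle (p· {t = var i} p q)          = p· (triangle p) (triangle q)
triangle (p· {t = t₁ · t₂} p q)        = p· (triangle p) (triangle q)
triangle (p· {t = ƛ t} (pƛ p) q)       = pβ (triangle p) (triangle q)
triangle (pβ p q)                      = ⇛-[] (triangle p) (triangle q)

⇛-diamond : ∀ {n} → Diamond (_⇛_ {n})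
⇛-diamond {a = t} p q = t ⁺ , triangle p , triangle q

⟶β⇒⇛ : ∀ {n} {t t' : Term n} → t ⟶β t' → t ⇛ t'
⟶β⇒⇛ (β {t} {u})        = pβ (⇛-refl t) (⇛-refl u)
⟶β⇒⇛ (ξƛ s)             = pƛ (⟶β⇒⇛ s)
⟶β⇒⇛ (ξ·ₗ {u = u} s)    = p· (⟶β⇒⇛ s) (⇛-refl u)
⟶β⇒⇛ (ξ·ᵣ {t = t} s)    = p· (⇛-refl t) (⟶β⇒⇛ s)

↠-ƛ : ∀ {n} {t t' : Term (suc n)} → t ↠ t' → ƛ t ↠ ƛ t'
↠-ƛ = Star.gmap ƛ_ ξƛ

↠-·ₗ : ∀ {n} {t t' : Term n} (u : Term n) → t ↠ t' → t · u ↠ t' · u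
↠-·ₗ u = Star.gmap (_· u) ξ·ₗ

↠-·ᵣ : ∀ {n} (t : Term n) {u u' : Term n} → u ↠ u' → t · u ↠ t · u'
↠-·ᵣ t = Star.gmap (t ·_) ξ·ᵣ

⇛⇒↠ : ∀ {n} {t t' : Term n} → t ⇛ t' → t ↠ t'
⇛⇒↠ pvar                          = ε
⇛⇒↠ (pƛ p)                        = ↠-ƛ (⇛⇒↠ p)
⇛⇒↠ (p· {t' = t'} {u = u} p q)    = ↠-·ₗ u (⇛⇒↠ p) ◅◅ ↠-·ᵣ t' (⇛⇒↠ q)
⇛⇒↠ (pβ {t' = t'} {u = u} p q)    =
  ↠-·ₗ u (↠-ƛ (⇛⇒↠ p)) ◅◅ ↠-·ᵣ (ƛ t') (⇛⇒↠ q) ◅◅ β ◅ ε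

β-confluent : ∀ {n} → Confluent (_⟶β_ {n})
β-confluent = confluent-sandwich ⟶β⇒⇛ ⇛⇒↠ (diamond⇒confluent ⇛-diamond)

-- Sort assignment.  Arr s a b reads "a term of sort s applied to a term of
-- sort a has sort b"; Lam s says that abstractions may be given sort s.

module SortAssignment {Sort : Set} (Lam : Sort → Set)
                      (Arr : Sort → Sort → Sort → Set) where

  Ctx : ℕ → Set
  Ctx n = Fin n → Sort

  infixr 5 _∷ᶜ_
  _∷ᶜ_ : ∀ {n} → Sort → Ctx n → Ctx (suc n)
  (a ∷ᶜ Γ) zero    = a
  (a ∷ᶜ Γ) (suc i) = Γ i

  ∅ : Ctx 0
  ∅ ()

  infix 4 _⊢_∶_
  data _⊢_∶_ {n : ℕ} (Γ : Ctx n) : Term n → Sort → Set where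
    tvar : ∀ {i s} → Γ i ≡ s → Γ ⊢ var i ∶ s
    tapp : ∀ {t u s a b} → Γ ⊢ t ∶ s → Arr s a b → Γ ⊢ u ∶ a → Γ ⊢ t · u ∶ b
    tlam : ∀ {t s} → Lam s → (∀ {a b} → Arr s a b → (a ∷ᶜ Γ) ⊢ t ∶ b) →
           Γ ⊢ ƛ t ∶ s

  ⊢-rename : ∀ {m n} {Γ : Ctx m} {Δ : Ctx n} (ρ : Ren m n) → (∀ i → Δ (ρ i) ≡ Γ i) →
             ∀ {t s} → Γ ⊢ t ∶ s → Δ ⊢ rename ρ t ∶ s
  ⊢-rename ρ ρ-ok (tvar refl)   = tvar (ρ-ok _)
  ⊢-rename ρ ρ-ok (tapp d r d') = tapp (⊢-rename ρ ρ-ok d) r (⊢-rename ρ ρ-ok d')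
  ⊢-rename ρ ρ-ok (tlam L f)    =
    tlam L (λ r → ⊢-rename (ext ρ) (λ { zero → refl ; (suc i) → ρ-ok i }) (f r))

  ⊢-subst : ∀ {m n} {Γ : Ctx m} {Δ : Ctx n} (σ : Sub m n) → (∀ i → Δ ⊢ σ i ∶ Γ i) →
            ∀ {t s} → Γ ⊢ t ∶ s → Δ ⊢ subst σ t ∶ s
  ⊢-subst σ σ-ok (tvar refl)   = σ-ok _
  ⊢-subst σ σ-ok (tapp d r d') = tapp (⊢-subst σ σ-ok d) r (⊢-subst σ σ-ok d')
  ⊢-subst σ σ-ok (tlam L f)    = tlam L (λ r → ⊢-subst (exts σ) exts-ok (f r))
    where
    exts-ok : ∀ {a} i → (a ∷ᶜ _) ⊢ exts σ i ∶ (a ∷ᶜ _) i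
    exts-ok zero    = tvar refl
    exts-ok (suc i) = ⊢-rename suc (λ _ → refl) (σ-ok i)

  ⊢-⟶β : ∀ {n} {Γ : Ctx n} {t t' s} → Γ ⊢ t ∶ s → t ⟶β t' → Γ ⊢ t' ∶ s
  ⊢-⟶β (tapp (tlam L f) r d) β = ⊢-subst (single _) (λ { zero → d ; (suc i) → tvar refl }) (f r)
  ⊢-⟶β (tlam L f)    (ξƛ st)  = tlam L (λ r → ⊢-⟶β (f r) st)
  ⊢-⟶β (tapp d r d') (ξ·ₗ st) = tapp (⊢-⟶β d st) r d'
  ⊢-⟶β (tapp d r d') (ξ·ᵣ st) = tapp d r (⊢-⟶β d' st)

  ⊢-↠ : ∀ {n} {Γ : Ctx n} {t t' s} → Γ ⊢ t ∶ s → t ↠ t' → Γ ⊢ t' ∶ s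
  ⊢-↠ d ε        = d
  ⊢-↠ d (x ◅ xs) = ⊢-↠ (⊢-⟶β d x) xs

record Separated {Sort : Set} (Arr : Sort → Sort → Sort → Set)
                 (_#_ : Sort → Sort → Set) (s s' : Sort) : Set where
  constructor separated
  field
    {a b a' b'} : Sort
    arr         : Arr s a b
    arr'        : Arr s' a' b'
    arguments   : ¬ (a # a')
    results     : b # b'

module Apartness {Sort : Set} (Lam : Sort → Set) (Arr : Sort → Sort → Sort → Set)
  (_#_ : Sort → Sort → Set)
  (#-app : ∀ {s a b s' a' b'} → Arr s a b → Arr s' a' b' → b # b' → s # s' ⊎ a # a')
  (#-lam : ∀ {s s'} → Lam s → Lam s' → s # s' → Separated Arr _#_ s s')
  where

  open SortAssignment Lam Arr

  sorts-not-apart : ∀ {n} {Γ Γ' : Ctx n} → (∀ i → ¬ (Γ i # Γ' i)) →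
                    ∀ {t s s'} → Γ ⊢ t ∶ s → Γ' ⊢ t ∶ s' → ¬ (s # s')
  sorts-not-apart Γ≁Γ' (tvar refl) (tvar refl) = Γ≁Γ' _
  sorts-not-apart Γ≁Γ' (tapp d r e) (tapp d' r' e') b#b' with #-app r r' b#b'
  ... | inj₁ s#s' = sorts-not-apart Γ≁Γ' d d' s#s'
  ... | inj₂ a#a' = sorts-not-apart Γ≁Γ' e e' a#a'
  sorts-not-apart {Γ = Γ} {Γ'} Γ≁Γ' (tlam L f) (tlam L' f') s#s'
    with #-lam L L' s#s'
  ... | separated r r' a≁a' b#b' = sorts-not-apart extended (f r) (f' r') b#b'
    where
    extended : ∀ i → ¬ ((_ ∷ᶜ Γ) i # (_ ∷ᶜ Γ') i)
    extended zero    = a≁a'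
    extended (suc i) = Γ≁Γ' i

  apart-sorts-separate : ∀ {n} {Γ Γ' : Ctx n} → (∀ i → ¬ (Γ i # Γ' i)) →
                         ∀ {t u s s'} → Γ ⊢ t ∶ s → Γ' ⊢ u ∶ s' → s # s' → ¬ (t =β u)
  apart-sorts-separate Γ≁Γ' ⊢t ⊢u s#s' t=u with confluent⇒church-rosser β-confluent t=u
  ... | v , t↠v , u↠v = sorts-not-apart Γ≁Γ' (⊢-↠ ⊢t t↠v) (⊢-↠ ⊢u u↠v) s#s'

-- Each sort names the behaviour of a specific
-- closed term: sS of S, sΣ of S S, sSI of S I, sI of I, sw of ωs, sw0 of
-- ω_f (for f of sort sF), sa1 of Turing's half-combinator Aθ, sO j of
-- Ωs S ⋯ S (j copies), sR n of the fixed-point combinator T n that U n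
-- reduces to, sF of the argument f of a fixed-point combinator, and
-- sX n of T n f.
data Srt : Set where
  sS sΣ sSI sI sw sw0 sa1 sF : Srt
  sO sR sX : ℕ → Srt

data Arr : Srt → Srt → Srt → Set where
  aSS  : Arr sS sS sΣ
  aSI  : Arr sS sI sSI
  aΣ   : ∀ {j} → Arr sΣ (sO j) (sO j)
  aSIR : ∀ {n} → Arr sSI (sR n) (sR n)
  aOS  : ∀ {j} → Arr (sO j) sS (sO (suc j))
  aOI  : ∀ {j} → Arr (sO j) sI (sR (suc (suc j)))
  aw   : Arr sw sw (sO 0)
  aw0  : Arr sw0 sw0 (sX 0)
  aa1  : Arr sa1 sa1 (sR 1)
  aR   : ∀ {n} → Arr (sR n) sF (sX n)
  aI   : Arr sI sF sF
  aF   : ∀ {n} → Arr sF (sX n) (sX n)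

data Lam : Srt → Set where
  lS  : Lam sS
  lΣ  : Lam sΣ
  lSI : Lam sSI
  lI  : Lam sI
  lw  : Lam sw
  lw0 : Lam sw0
  la1 : Lam sa1
  lO  : ∀ {j} → Lam (sO j)
  lR  : ∀ {n} → Lam (sR n)

open SortAssignment Lam Arr

data _#₀_ : Srt → Srt → Set where
  RR   : ∀ {n m} → n ≢ m → sR n #₀ sR m
  XX   : ∀ {n m} → n ≢ m → sX n #₀ sX m
  OO   : ∀ {n m} → n ≢ m → sO n #₀ sO m
  FX   : ∀ {m} → sF #₀ sX m
  w0F  : sw0 #₀ sF
  IR   : ∀ {m} → sI #₀ sR m
  Oa1  : ∀ {m} → sO m #₀ sa1
  SIa1 : sSI #₀ sa1
  SO   : ∀ {m} → sS #₀ sO m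
  SIR  : ∀ {m} → sSI #₀ sR m
  R0X  : ∀ {m} → sR 0 #₀ sX m
  SIw0 : sSI #₀ sw0
  Sa1  : sS #₀ sa1
  wO   : ∀ {m} → sw #₀ sO m

_#_ : Srt → Srt → Set
_#_ = SymClosure _#₀_

#-sym : ∀ {a b} → a # b → b # a
#-sym = SymClosure.symmetric _#₀_

suc-≢ : ∀ {j k : ℕ} → j ≢ k → suc j ≢ suc k
suc-≢ j≢k refl = j≢k refl

suc-≢⁻¹ : ∀ {j k : ℕ} → suc j ≢ suc k → j ≢ k
suc-≢⁻¹ sj≢sk refl = sj≢sk refl

#₀-app : ∀ {s a b s' a' b'} → Arr s a b → Arr s' a' b' → b #₀ b' → s # s' ⊎ a # a'
#₀-app aSIR aSIR (RR ne) = inj₂ (fwd (RR ne))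
#₀-app aSIR aOI  (RR ne) = inj₂ (bwd IR)
#₀-app aSIR aa1  (RR ne) = inj₁ (fwd SIa1)
#₀-app aOI  aSIR (RR ne) = inj₂ (fwd IR)
#₀-app aOI  aOI  (RR ne) = inj₁ (fwd (OO (suc-≢⁻¹ (suc-≢⁻¹ ne))))
#₀-app aOI  aa1  (RR ne) = inj₁ (fwd Oa1)
#₀-app aa1  aSIR (RR ne) = inj₁ (bwd SIa1)
#₀-app aa1  aOI  (RR ne) = inj₁ (bwd Oa1)
#₀-app aa1  aa1  (RR ne) = ⊥-elim (ne refl)
#₀-app aw0  aw0  (XX ne) = ⊥-elim (ne refl)
#₀-app aw0  aR   (XX ne) = inj₂ (fwd w0F)
#₀-app aw0  aF   (XX ne) = inj₁ (fwd w0F)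
#₀-app aR   aw0  (XX ne) = inj₂ (bwd w0F)
#₀-app aR   aR   (XX ne) = inj₁ (fwd (RR ne))
#₀-app aR   aF   (XX ne) = inj₂ (fwd FX)
#₀-app aF   aw0  (XX ne) = inj₁ (bwd w0F)
#₀-app aF   aR   (XX ne) = inj₂ (bwd FX)
#₀-app aF   aF   (XX ne) = inj₂ (fwd (XX ne))
#₀-app aΣ   aΣ   (OO ne) = inj₂ (fwd (OO ne))
#₀-app aΣ   aOS  (OO ne) = inj₂ (bwd SO)
#₀-app aΣ   aw   (OO ne) = inj₂ (bwd wO)
#₀-app aOS  aΣ   (OO ne) = inj₂ (fwd SO)
#₀-app aOS  aOS  (OO ne) = inj₁ (fwd (OO (suc-≢⁻¹ ne)))
#₀-app aOS  aw   (OO ne) = inj₁ (bwd wO)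
#₀-app aw   aΣ   (OO ne) = inj₂ (fwd wO)
#₀-app aw   aOS  (OO ne) = inj₁ (fwd wO)
#₀-app aw   aw   (OO ne) = ⊥-elim (ne refl)
#₀-app aI   aw0  FX      = inj₂ (bwd w0F)
#₀-app aI   aR   FX      = inj₁ (fwd IR)
#₀-app aI   aF   FX      = inj₂ (fwd FX)
#₀-app aSI  aSIR SIR     = inj₂ (fwd IR)
#₀-app aSI  aOI  SIR     = inj₁ (fwd SO)
#₀-app aSI  aa1  SIR     = inj₁ (fwd Sa1)
#₀-app aSIR aw0  R0X     = inj₁ (fwd SIw0)
#₀-app aSIR aR   R0X     = inj₁ (fwd SIR)
#₀-app aSIR aF   R0X     = inj₂ (fwd R0X)

#-app : ∀ {s a b s' a' b'} → Arr s a b → Arr s' a' b' → b # b' → s # s' ⊎ a # a'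
#-app r r' (fwd b#₀b') = #₀-app r r' b#₀b'
#-app r r' (bwd b'#₀b) = Sum.map #-sym #-sym (#₀-app r' r b'#₀b)

F≁F : ¬ (sF # sF)
F≁F (fwd ())
F≁F (bwd ())

I≁I : ¬ (sI # sI)
I≁I (fwd ())
I≁I (bwd ())

I≁a1 : ¬ (sI # sa1)
I≁a1 (fwd ())
I≁a1 (bwd ())

R0≁a1 : ¬ (sR 0 # sa1)
R0≁a1 (fwd ())
R0≁a1 (bwd ())

R0≁F : ¬ (sR 0 # sF)
R0≁F (fwd ())
R0≁F (bwd ())

R0≁w0 : ¬ (sR 0 # sw0)
R0≁w0 (fwd ())
R0≁w0 (bwd ())

w≁S : ¬ (sw # sS)
w≁S (fwd ())
w≁S (bwd ())

#₀-lam : ∀ {s s'} → Lam s → Lam s' → s #₀ s' → Separated Arr _#_ s s'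
#₀-lam lR  lR  (RR ne) = separated aR aR F≁F (fwd (XX ne))
#₀-lam lO  lO  (OO ne) = separated aOI aOI I≁I (fwd (RR (suc-≢ (suc-≢ ne))))
#₀-lam lI  lR  IR      = separated aI aR F≁F (fwd FX)
#₀-lam lO  la1 Oa1     = separated aOI aa1 I≁a1 (fwd (RR λ ()))
#₀-lam lSI la1 SIa1    = separated (aSIR {0}) aa1 R0≁a1 (fwd (RR λ ()))
#₀-lam lS  lO  SO      = separated aSI aOI I≁I (fwd SIR)
#₀-lam lSI lR  SIR     = separated (aSIR {0}) aR R0≁F (fwd R0X)
#₀-lam lSI lw0 SIw0    = separated (aSIR {0}) aw0 R0≁w0 (fwd R0X)
#₀-lam lS  la1 Sa1     = separated aSI aa1 I≁a1 (fwd SIR)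
#₀-lam lw  lO  wO      = separated aw aOS w≁S (fwd (OO λ ()))

#-lam : ∀ {s s'} → Lam s → Lam s' → s # s' → Separated Arr _#_ s s'
#-lam L L' (fwd s#₀s') = #₀-lam L L' s#₀s'
#-lam L L' (bwd s'#₀s) with #₀-lam L' L s'#₀s
... | separated r' r a'≁a b'#b = separated r r' (a'≁a ∘ #-sym) (#-sym b'#b)

open Apartness Lam Arr _#_ #-app #-lam

ωs : Term 0
ωs = ƛ ƛ ƛ (x1 · x0 · (x2 · x2 · x1 · x0))

Ωs : Term 0
Ωs = ωs · ωs

Aθ : Term 0
Aθ = ƛ ƛ (var zero · (var (suc zero) · var (suc zero) · var zero))

ΩsSᵏ : ℕ → Term 0
ΩsSᵏ zero    = Ωs
ΩsSᵏ (suc k) = ΩsSᵏ k · S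

T : ℕ → Term 0
T zero          = Y₀
T (suc zero)    = Aθ · Aθ
T (suc (suc k)) = ΩsSᵏ k · I

-- B Y₀ I reduces to λz. Y₀ z, which is Y₀ itself.
U0↠T0 : U 0 ↠ Y₀
U0↠T0 = ξ·ₗ β ◅ β ◅ ξƛ (ξ·ᵣ β) ◅ ξƛ β ◅ ε

-- B Y₀ S I reduces to Y₀ (S I) = ω ω with ω = λx. S I (x x), and
-- S I (x x) reduces to λy. y (x x y), so ω reduces to Aθ.
U1↠T1 : U 1 ↠ Aθ · Aθ
U1↠T1 = ξ·ₗ (ξ·ₗ β) ◅ ξ·ₗ β ◅ β ◅ β
  ◅ ξ·ₗ (ξƛ (ξ·ₗ β)) ◅ ξ·ₗ (ξƛ β) ◅ ξ·ₗ (ξƛ (ξƛ (ξ·ₗ β)))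
  ◅ ξ·ᵣ (ξƛ (ξ·ₗ β)) ◅ ξ·ᵣ (ξƛ β) ◅ ξ·ᵣ (ξƛ (ξƛ (ξ·ₗ β))) ◅ ε

-- B Y₀ S S reduces to ω ω with ω = λx. S S (x x), and S S (x x) reduces
-- to λyz. y z (x x y z), so ω reduces to ωs; further copies of S are
-- carried along.
BY₀SS↠Ωs : BY₀Sⁿ 2 ↠ Ωs
BY₀SS↠Ωs = ξ·ₗ (ξ·ₗ β) ◅ ξ·ₗ β ◅ β ◅ β
  ◅ ξ·ₗ (ξƛ (ξ·ₗ β)) ◅ ξ·ₗ (ξƛ β) ◅ ξ·ₗ (ξƛ (ξƛ (ξ·ₗ β))) ◅ ξ·ₗ (ξƛ (ξƛ β))
  ◅ ξ·ᵣ (ξƛ (ξ·ₗ β)) ◅ ξ·ᵣ (ξƛ β) ◅ ξ·ᵣ (ξƛ (ξƛ (ξ·ₗ β))) ◅ ξ·ᵣ (ξƛ (ξƛ β)) ◅ ε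

BY₀Sᵏ⁺²↠ΩsSᵏ : ∀ k → BY₀Sⁿ (suc (suc k)) ↠ ΩsSᵏ k
BY₀Sᵏ⁺²↠ΩsSᵏ zero    = BY₀SS↠Ωs
BY₀Sᵏ⁺²↠ΩsSᵏ (suc k) = ↠-·ₗ S (BY₀Sᵏ⁺²↠ΩsSᵏ k)

U↠T : ∀ n → U n ↠ T n
U↠T zero          = U0↠T0
U↠T (suc zero)    = U1↠T1
U↠T (suc (suc k)) = ↠-·ₗ I (BY₀Sᵏ⁺²↠ΩsSᵏ k)

⊢S : ∅ ⊢ S ∶ sS
⊢S = tlam lS λ
  { aSS → tlam lΣ λ { aΣ → tlam lO λ
      { aOS → tapp (tapp (tvar refl) aSS (tvar refl)) aΣ (tapp (tvar refl) aOS (tvar refl))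
      ; aOI → tapp (tapp (tvar refl) aSI (tvar refl)) aSIR (tapp (tvar refl) aOI (tvar refl)) } }
  ; aSI → tlam lSI λ { aSIR → tlam lR λ
      { aR → tapp (tapp (tvar refl) aI (tvar refl)) aF (tapp (tvar refl) aR (tvar refl)) } } }

⊢I : ∅ ⊢ I ∶ sI
⊢I = tlam lI λ { aI → tvar refl }

⊢ωs : ∅ ⊢ ωs ∶ sw
⊢ωs = tlam lw λ { aw → tlam lO λ
  { aOS → tlam lO λ { aOS → body-SS ; aOI → body-SI }
  ; aOI → tlam lR λ { aR → body-IF } } }
  where
  body : Term 3
  body = x1 · x0 · (x2 · x2 · x1 · x0)
  body-SS : (sS ∷ᶜ sS ∷ᶜ sw ∷ᶜ ∅) ⊢ body ∶ sO 2
  body-SS = tapp (tapp (tvar refl) aSS (tvar refl)) aΣ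
                 (tapp (tapp (tapp (tvar refl) aw (tvar refl)) aOS (tvar refl)) aOS (tvar refl))
  body-SI : (sI ∷ᶜ sS ∷ᶜ sw ∷ᶜ ∅) ⊢ body ∶ sR 3
  body-SI = tapp (tapp (tvar refl) aSI (tvar refl)) aSIR
                 (tapp (tapp (tapp (tvar refl) aw (tvar refl)) aOS (tvar refl)) aOI (tvar refl))
  body-IF : (sF ∷ᶜ sI ∷ᶜ sw ∷ᶜ ∅) ⊢ body ∶ sX 2
  body-IF = tapp (tapp (tvar refl) aI (tvar refl)) aF
                 (tapp (tapp (tapp (tvar refl) aw (tvar refl)) aOI (tvar refl)) aR (tvar refl))

⊢ΩsSᵏ : ∀ k → ∅ ⊢ ΩsSᵏ k ∶ sO k
⊢ΩsSᵏ zero    = tapp ⊢ωs aw ⊢ωs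
⊢ΩsSᵏ (suc k) = tapp (⊢ΩsSᵏ k) aOS ⊢S

⊢ωf : (sF ∷ᶜ ∅) ⊢ ωf ∶ sw0
⊢ωf = tlam lw0 λ { aw0 → tapp (tvar refl) aF (tapp (tvar refl) aw0 (tvar refl)) }

⊢Aθ : ∅ ⊢ Aθ ∶ sa1
⊢Aθ = tlam la1 λ { aa1 → tlam lR λ
  { aR → tapp (tvar refl) aF (tapp (tapp (tvar refl) aa1 (tvar refl)) aR (tvar refl)) } }

⊢T : ∀ n → ∅ ⊢ T n ∶ sR n
⊢T zero          = tlam lR λ { aR → tapp ⊢ωf aw0 ⊢ωf }
⊢T (suc zero)    = tapp ⊢Aθ aa1 ⊢Aθ
⊢T (suc (suc k)) = tapp (⊢ΩsSᵏ k) aOI ⊢I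

corollary31 : ∀ (n m : ℕ) → n ≢ m → ¬ (U n =β U m)
corollary31 n m n≢m Un=Um =
  apart-sorts-separate (λ ()) (⊢T n) (⊢T m) (fwd (RR n≢m)) Tn=Tm
  where
  Tn=Tm : T n =β T m
  Tn=Tm = a—↠b⇒b↔a (U↠T n) ◅◅ Un=Um ◅◅ a—↠b⇒a↔b (U↠T m)
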